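{- Let $\lambda\neq\emptyset$ be a partition. Then $c^\lambda_{sp}(u)\ne0$ for all cells $u\in\lambda$ if and only if for all cells $(i,j)\in\lambda$, $$c^\lambda_{sp}(i,j)=\begin{cases} h^\lambda(i,j) & \text{if } i>j,\\ -h^\lambda(i,j) & \text{if } i\le j.\end{cases}$$
   Context: For a partition $\lambda$ with conjugate $\lambda'$ (cells $(i,j)$ = row $i$, column $j$ of the Young diagram; $\lambda_i=0$ beyond the length), the hook length of $(i,j)\in\lambda$ is $h^\lambda(i,j)=\lambda_i+\lambda'_j-i-j+1$, and the symplectic content is $c^\lambda_{sp}(i,j)=\lambda_i+\lambda_j-i-j+2$ if $i>j$, and $c^\lambda_{sp}(i,j)=i+j-\lambda'_i-\lambda'_j$ if $i\le j$. -}

module Defs where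

open import Data.Nat using (ℕ; zero; suc; _≤_; _<_; _≥_; _≤ᵇ_)
open import Data.Integer as ℤ using (ℤ; +_; _-_)
open import Data.List using (List; []; _∷_; length; filter)
open import Data.List.Relation.Unary.All using (All)
open import Data.List.Relation.Unary.Linked using (Linked)
open import Data.Product using (_×_)
open import Relation.Nullary.Decidable using (Dec)
open import Data.Nat.Properties using (_≤?_)
open import Data.Bool using (if_then_else_)

record Partition : Set where
  constructor mkPartition
  field
    parts      : List ℕ
    decreasing : Linked _≥_ parts
    positive   : All (λ p → 1 ≤ p) parts
open Partition public

-- 1-indexed row length λ_i (zero beyond the length; λ_0 := 0, unused)
part : List ℕ → ℕ → ℕ
part []       _             = 0
part (x ∷ xs) zero          = 0
part (x ∷ xs) (suc zero)    = x
part (x ∷ xs) (suc (suc i)) = part xs (suc i)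

row : Partition → ℕ → ℕ
row λp i = part (parts λp) i

col : Partition → ℕ → ℕ
col λp j = length (filter (λ p → j ≤? p) (parts λp))

Cell : Partition → ℕ → ℕ → Set
Cell λp i j = (1 ≤ i) × (1 ≤ j) × (j ≤ row λp i)

hook : Partition → ℕ → ℕ → ℤ
hook λp i j = (+ row λp i ℤ.+ + col λp j ℤ.+ + 1) - (+ i ℤ.+ + j)

csp : Partition → ℕ → ℕ → ℤ
csp λp i j = if suc j ≤ᵇ i
  then (+ row λp i ℤ.+ + row λp j ℤ.+ + 2) - (+ i ℤ.+ + j)
  else (+ i ℤ.+ + j) - (+ col λp i ℤ.+ + col λp j)

NonEmpty : Partition → Set
NonEmpty λp = 1 ≤ length (parts λp)

-- In terms of row lengths λ_i and column lengths λ'_j, both formulas for c_sp agree with ±h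
-- exactly when λ'_m = λ_m + 1 for every diagonal cell (m,m) (the cell (i,j) involves the
-- diagonal cell of index min i j), and hook lengths are positive: this gives one direction.
-- Conversely, if c_sp never vanishes, λ'_k = λ_k + 1 is proved for diagonal cells from the
-- bottom up. If λ'_k ≤ λ_k, the content k + j − λ'_k − λ'_j of row k goes from ≤ 0 at j = k
-- to > 0 at j = λ_k + 1, increasing by at least 1 per step; it can only jump over 0 where
-- λ'_j drops, and such a jump at j gives a row i with λ_i = j and i + λ'_k = λ_i + k + 1,
-- which is impossible once λ'_m = λ_m + 1 holds further down the diagonal. If
-- λ'_k ≥ λ_k + 2, the same argument for the conjugate partition finds a zero in column k.
module Submission where

open import Defs
open import Data.Nat using (ℕ; _<_; _≤_)
open import Data.Integer using (ℤ; -_; +_)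
open import Relation.Binary.PropositionalEquality using (_≡_)
open import Relation.Nullary using (¬_)
open import Function.Bundles using (_⇔_)
open import Data.Product using (_×_)

open import Data.Nat using (suc; zero; _+_; _∸_; _≥_; z≤n; s≤s; s≤s⁻¹)
open import Data.Nat.Properties
open import Data.Product using (_,_; ∃-syntax)
open import Data.Bool using (Bool; if_then_else_)
open import Data.Empty using (⊥-elim)
open import Data.List using (_∷_; []; length; filter)
open import Data.List.Properties using (filter-accept; filter-none)
open import Data.List.Relation.Unary.All as All using (All)
open import Data.List.Relation.Unary.Linked as Linked using (Linked)
open import Data.List.Relation.Unary.Linked.Properties using (Linked⇒All)
import Data.Integer as ℤ
import Data.Integer.Properties as ℤ
open import Function using (_∘_; flip)
open import Function.Bundles using (Equivalence; mk⇔)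
open import Function.Construct.Symmetry using (⇔-sym)
open import Relation.Binary.Definitions using (tri<; tri≈; tri>)
open import Relation.Binary.PropositionalEquality
  using (_≢_; refl; sym; trans; cong; subst; module ≡-Reasoning)
open import Relation.Nullary using (yes; no; contradiction)
open import Relation.Nullary.Decidable using (dec-true; dec-false)
open import Relation.Unary using (Decidable)

crossing : ∀ {p} {P : ℕ → Set p} → Decidable P → ∀ {a b} → a ≤ b → P a → ¬ P b →
           ∃[ j ] a ≤ j × j < b × P j × ¬ P (suc j)
crossing P? {b = zero} z≤n Pa ¬Pb = contradiction Pa ¬Pb
crossing P? {a} {suc b} a≤1+b Pa ¬P1+b
  with s≤s⁻¹ (≤∧≢⇒< a≤1+b λ { refl → ¬P1+b Pa }) | P? b
... | a≤b | yes Pb  = b , a≤b , n<1+n b , Pb , ¬P1+b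
... | a≤b | no ¬Pb  with crossing P? a≤b Pa ¬Pb
...   | j , a≤j , j<b , Pj , ¬P1+j = j , a≤j , m<n⇒m<1+n j<b , Pj , ¬P1+j

Conjugate : (ℕ → ℕ) → (ℕ → ℕ) → Set
Conjugate r c = ∀ {i j} → 1 ≤ i → 1 ≤ j → j ≤ r i ⇔ i ≤ c j

conjugate-sym : ∀ {r c} → Conjugate r c → Conjugate c r
conjugate-sym conj 1≤i 1≤j = ⇔-sym (conj 1≤j 1≤i)

module _ {r c : ℕ → ℕ} (conj : Conjugate r c) where

  row⇒col : ∀ {i j} → 1 ≤ i → 1 ≤ j → j ≤ r i → i ≤ c j
  row⇒col 1≤i 1≤j = Equivalence.to (conj 1≤i 1≤j)

  col⇒row : ∀ {i j} → 1 ≤ i → 1 ≤ j → i ≤ c j → j ≤ r i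
  col⇒row 1≤i 1≤j = Equivalence.from (conj 1≤i 1≤j)

  r-antitone : ∀ {i i′} → 1 ≤ i → i ≤ i′ → r i′ ≤ r i
  r-antitone 1≤i i≤i′ = ≮⇒≥ λ ri<ri′ →
    1+n≰n (col⇒row 1≤i (s≤s z≤n) (≤-trans i≤i′ (row⇒col (≤-trans 1≤i i≤i′) (s≤s z≤n) ri<ri′)))

  row-of-gap : ∀ {a s j} → 1 ≤ j → a + c (suc j) < s → s ≤ a + c j →
               ∃[ i ] 1 ≤ i × r i ≡ j × i + a ≡ s
  row-of-gap {a} {s} {j} 1≤j above-gap below-gap = i , 1≤i , ri≡j , i+a≡s
    where
      i = s ∸ a
      i+a≡s : i + a ≡ s
      i+a≡s = m∸n+n≡m (≤-trans (m≤m+n a _) (<⇒≤ above-gap))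
      a+i≡s : a + i ≡ s
      a+i≡s = trans (+-comm a i) i+a≡s
      c[1+j]<i : c (suc j) < i
      c[1+j]<i = +-cancelˡ-< a _ _ (subst (_ <_) (sym a+i≡s) above-gap)
      1≤i : 1 ≤ i
      1≤i = ≤-trans (s≤s z≤n) c[1+j]<i
      i≤cj : i ≤ c j
      i≤cj = +-cancelˡ-≤ a _ _ (subst (_≤ _) (sym a+i≡s) below-gap)
      ri≡j : r i ≡ j
      ri≡j = ≤-antisym (≮⇒≥ λ j<ri → <⇒≱ c[1+j]<i (row⇒col 1≤i (s≤s z≤n) j<ri)) (col⇒row 1≤i 1≤j i≤cj)

c-antitone : ∀ {r c} → Conjugate r c → ∀ {j j′} → 1 ≤ j → j ≤ j′ → c j′ ≤ c j
c-antitone conj = r-antitone (conjugate-sym conj)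

-- With o = 0 this finds a zero of the content in row k; with o = 2, applied to the conjugate,
-- a zero in column k.
module _ {r c : ℕ → ℕ} (conj : Conjugate r c) (o : ℕ) {k : ℕ}
         (1≤k : 1 ≤ k) (k≤rk : k ≤ r k) (o+ck≤rk : o + c k ≤ r k)
         (balanced-below : ∀ {m} → k < m → m ≤ r m → o + c m ≡ suc (r m)) where

  private
    k≤ck : k ≤ c k
    k≤ck = row⇒col conj 1≤k 1≤k k≤rk

  no-row-jump : ∀ {i} → 1 ≤ i → i + (o + c k) ≢ suc (r i + k)
  no-row-jump {i} 1≤i eq with i ≤? k | i ≤? r i
  ... | yes i≤k | _ = <-irrefl eq (begin-strict
        i + (o + c k) ≤⟨ +-mono-≤ i≤k (≤-trans o+ck≤rk (r-antitone conj 1≤i i≤k)) ⟩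
        k + r i       ≡⟨ +-comm k (r i) ⟩
        r i + k       <⟨ n<1+n _ ⟩
        suc (r i + k) ∎)
    where open ≤-Reasoning
  ... | no i≰k | yes i≤ri = <-irrefl (sym eq) (begin-strict
        suc (r i) + k ≡⟨ cong (_+ k) (balanced-below k<i i≤ri) ⟨
        o + c i + k   ≤⟨ +-monoˡ-≤ k (+-monoʳ-≤ o (c-antitone conj 1≤k (<⇒≤ k<i))) ⟩
        o + c k + k   <⟨ +-monoʳ-< (o + c k) k<i ⟩
        o + c k + i   ≡⟨ +-comm (o + c k) i ⟩
        i + (o + c k) ∎)
    where open ≤-Reasoning
          k<i = ≰⇒> i≰k
  ... | no i≰k | no i≰ri = <-irrefl (sym eq) (begin-strict
        suc (r i) + k ≤⟨ +-monoˡ-≤ k (≰⇒> i≰ri) ⟩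
        i + k         <⟨ +-monoʳ-< i (≰⇒> i≰k) ⟩
        i + i         ≤⟨ +-monoʳ-≤ i (≤-trans i≤ck (m≤n+m (c k) o)) ⟩
        i + (o + c k) ∎)
    where
      open ≤-Reasoning
      i≤1+ri : i ≤ suc (r i)
      i≤1+ri = +-cancelʳ-≤ k i (suc (r i)) (begin
        i + k         ≤⟨ +-monoʳ-≤ i (≤-trans k≤ck (m≤n+m (c k) o)) ⟩
        i + (o + c k) ≡⟨ eq ⟩
        suc (r i) + k ∎)
      i≤ck : i ≤ c k
      i≤ck = row⇒col conj 1≤i 1≤k (s≤s⁻¹ (≤-trans (≰⇒> i≰k) i≤1+ri))

  private
    past-row-end : ¬ (suc (r k) + k ≤ o + c k + c (suc (r k)))
    past-row-end = <⇒≱ (begin-strict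
      o + c k + c (suc (r k)) <⟨ +-mono-≤-< o+ck≤rk c[1+rk]<k ⟩
      r k + k                 <⟨ n<1+n _ ⟩
      suc (r k) + k           ∎)
      where
        open ≤-Reasoning
        c[1+rk]<k : c (suc (r k)) < k
        c[1+rk]<k = ≰⇒> λ k≤c[1+rk] → 1+n≰n (col⇒row conj 1≤k (s≤s z≤n) k≤c[1+rk])

  row-crossing : ∃[ j ] k ≤ j × j ≤ r k × k + j ≡ o + c k + c j
  row-crossing with crossing (λ j → j + k ≤? o + c k + c j) (m≤n⇒m≤1+n k≤rk)
                             (+-mono-≤ (≤-trans k≤ck (m≤n+m (c k) o)) k≤ck) past-row-end
  ... | j , k≤j , j<1+rk , Pj , ¬P[1+j] with j + k ≟ o + c k + c j
  ...   | yes eq = j , k≤j , s≤s⁻¹ j<1+rk , trans (+-comm k j) eq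
  ...   | no ¬eq with row-of-gap conj (≤-trans 1≤k k≤j) (≰⇒> ¬P[1+j]) (≤∧≢⇒< Pj ¬eq)
  ...     | i , 1≤i , ri≡j , i+o+ck≡1+j+k =
              contradiction (trans i+o+ck≡1+j+k (cong (λ x → suc (x + k)) (sym ri≡j)))
                            (no-row-jump 1≤i)

module _ {r c : ℕ → ℕ} (conj : Conjugate r c) {k : ℕ} (1≤k : 1 ≤ k) (k≤rk : k ≤ r k)
         (balanced-below : ∀ {m} → k < m → m ≤ r m → c m ≡ suc (r m)) where

  zero-in-row : c k ≤ r k → ∃[ j ] k ≤ j × j ≤ r k × k + j ≡ c k + c j
  zero-in-row ck≤rk = row-crossing conj 0 1≤k k≤rk ck≤rk balanced-below

  private
    transposed-balanced-below : ∀ {m} → k < m → m ≤ c m → 2 + r m ≡ suc (c m)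
    transposed-balanced-below {m} k<m m≤cm =
      cong suc (sym (balanced-below k<m (col⇒row conj 1≤m 1≤m m≤cm)))
      where 1≤m = ≤-trans 1≤k (<⇒≤ k<m)

  zero-in-column : 2 + r k ≤ c k → ∃[ i ] k < i × k ≤ r i × k + i ≡ 2 + r k + r i
  zero-in-column 2+rk≤ck
    with row-crossing (conjugate-sym conj) 2 1≤k (row⇒col conj 1≤k 1≤k k≤rk) 2+rk≤ck
                      transposed-balanced-below
  ... | i , k≤i , i≤ck , eq = i , k<i , col⇒row conj (≤-trans 1≤k k≤i) 1≤k i≤ck , eq
    where
      k<i : k < i
      k<i = ≤∧≢⇒< k≤i λ { refl → <-irrefl eq (≤-trans (s≤s (+-mono-≤ k≤rk k≤rk)) (n≤1+n _)) }

module _ {r c : ℕ → ℕ} (conj : Conjugate r c)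
         (no-zero-in-row : ∀ {k j} → 1 ≤ k → k ≤ j → j ≤ r k → k + j ≢ c k + c j)
         (no-zero-in-column : ∀ {k i} → 1 ≤ k → k < i → k ≤ r i → k + i ≢ 2 + r k + r i) where

  balanced-step : ∀ {k} → 1 ≤ k → k ≤ r k → (∀ {m} → k < m → m ≤ r m → c m ≡ suc (r m)) →
                  c k ≡ suc (r k)
  balanced-step {k} 1≤k k≤rk balanced-below with <-cmp (c k) (suc (r k))
  ... | tri≈ _ eq _ = eq
  ... | tri< ck<1+rk _ _ with zero-in-row conj 1≤k k≤rk balanced-below (s≤s⁻¹ ck<1+rk)
  ...   | j , k≤j , j≤rk , eq = contradiction eq (no-zero-in-row 1≤k k≤j j≤rk)
  balanced-step {k} 1≤k k≤rk balanced-below | tri> _ _ 2+rk≤ck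
    with zero-in-column conj 1≤k k≤rk balanced-below 2+rk≤ck
  ... | i , k<i , k≤ri , eq = contradiction eq (no-zero-in-column 1≤k k<i k≤ri)

  -- Downward induction along the diagonal, with fuel n bounding the distance to r 1.
  balanced-from : ∀ n {m} → r 1 < n + m → 1 ≤ m → m ≤ r m → c m ≡ suc (r m)
  balanced-from zero    r1<m  1≤m m≤rm =
    contradiction (≤-trans m≤rm (r-antitone conj (s≤s z≤n) 1≤m)) (<⇒≱ r1<m)
  balanced-from (suc n) {m} r1<1+n+m 1≤m m≤rm = balanced-step 1≤m m≤rm λ {m′} m<m′ →
    balanced-from n (≤-trans r1<1+n+m (≤-trans (≤-reflexive (sym (+-suc n m))) (+-monoʳ-≤ n m<m′)))
                    (≤-trans 1≤m (<⇒≤ m<m′))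

  balanced : ∀ {m} → 1 ≤ m → m ≤ r m → c m ≡ suc (r m)
  balanced {m} = balanced-from (suc (r 1)) (≤-trans (n<1+n (r 1)) (m≤m+n (suc (r 1)) m))

j≰head⇒j≰all : ∀ {j x xs} → Linked _≥_ (x ∷ xs) → ¬ j ≤ x → All (λ p → ¬ j ≤ p) (x ∷ xs)
j≰head⇒j≰all sorted j≰x =
  All.map (λ p≤x j≤p → j≰x (≤-trans j≤p p≤x)) (Linked⇒All (flip ≤-trans) ≤-refl sorted)

part-conjugate : ∀ xs → Linked _≥_ xs → Conjugate (part xs) (λ j → length (filter (j ≤?_) xs))
part-conjugate [] _ 1≤i 1≤j = mk⇔ (⊥-elim ∘ <⇒≱ 1≤j) (⊥-elim ∘ <⇒≱ 1≤i)
part-conjugate (x ∷ xs) sorted {i} {j} 1≤i 1≤j with j ≤? x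
... | no j≰x rewrite filter-none (j ≤?_) (j≰head⇒j≰all sorted j≰x) =
  mk⇔ (⊥-elim ∘ not-in-row i 1≤i) (⊥-elim ∘ <⇒≱ 1≤i)
  where
    not-in-row : ∀ i → 1 ≤ i → ¬ j ≤ part (x ∷ xs) i
    not-in-row (suc zero)    _ = j≰x
    not-in-row (suc (suc i)) _ j≤part = contradiction
      (subst (λ ys → suc i ≤ length ys) (filter-none (j ≤?_) (All.tail (j≰head⇒j≰all sorted j≰x)))
             (Equivalence.to (part-conjugate xs (Linked.tail sorted) (s≤s z≤n) 1≤j) j≤part))
      λ ()
... | yes j≤x rewrite filter-accept (j ≤?_) {xs = xs} j≤x with i | 1≤i
...   | suc zero    | _ = mk⇔ (λ _ → s≤s z≤n) (λ _ → j≤x)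
...   | suc (suc i) | _ = mk⇔ (s≤s ∘ Equivalence.to IH) (Equivalence.from IH ∘ s≤s⁻¹)
  where IH = part-conjugate xs (Linked.tail sorted) (s≤s z≤n) 1≤j

partition-conjugate : (λp : Partition) → Conjugate (row λp) (col λp)
partition-conjugate λp = part-conjugate (parts λp) (decreasing λp)

+m-+n≡0⇒m≡n : ∀ {m n} → + m ℤ.- + n ≡ + 0 → m ≡ n
+m-+n≡0⇒m≡n {m} {n} = ℤ.+-injective ∘ ℤ.i-j≡0⇒i≡j (+ m) (+ n)

m≡n⇒+m-+n≡0 : ∀ {m n} → m ≡ n → + m ℤ.- + n ≡ + 0
m≡n⇒+m-+n≡0 {m} refl = ℤ.+-inverseʳ (+ m)

-[+m-+n]≡+n-+m : ∀ m n → - (+ m ℤ.- + n) ≡ + n ℤ.- + m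
-[+m-+n]≡+n-+m m n = begin
  - (+ m ℤ.- + n) ≡⟨ cong -_ (ℤ.m-n≡m⊖n m n) ⟩
  - (m ℤ.⊖ n)     ≡⟨ ℤ.⊖-swap n m ⟨
  n ℤ.⊖ m         ≡⟨ ℤ.m-n≡m⊖n n m ⟨
  + n ℤ.- + m     ∎
  where open ≡-Reasoning

module _ (λp : Partition) where

  private
    r = row λp
    c = col λp

    csp-cases : ℕ → ℕ → Bool → ℤ
    csp-cases i j below = if below then + (r i + r j + 2) ℤ.- + (i + j) else + (i + j) ℤ.- + (c i + c j)

  csp-below : ∀ {i j} → j < i → csp λp i j ≡ + (r i + r j + 2) ℤ.- + (i + j)
  csp-below {i} {j} j<i = cong (csp-cases i j) (dec-true (suc j ≤? i) j<i)

  csp-above : ∀ {i j} → i ≤ j → csp λp i j ≡ + (i + j) ℤ.- + (c i + c j)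
  csp-above {i} {j} i≤j = cong (csp-cases i j) (dec-false (suc j ≤? i) (≤⇒≯ i≤j))

  csp-below-zero : ∀ {k i} → k < i → k + i ≡ 2 + r k + r i → csp λp i k ≡ + 0
  csp-below-zero {k} {i} k<i eq = trans (csp-below k<i) (m≡n⇒+m-+n≡0 (begin
    r i + r k + 2   ≡⟨ +-comm (r i + r k) 2 ⟩
    2 + (r i + r k) ≡⟨ cong (λ x → 2 + x) (+-comm (r i) (r k)) ⟩
    2 + r k + r i   ≡⟨ eq ⟨
    k + i           ≡⟨ +-comm k i ⟩
    i + k           ∎))
    where open ≡-Reasoning

  csp-above-zero : ∀ {k j} → k ≤ j → k + j ≡ c k + c j → csp λp k j ≡ + 0
  csp-above-zero k≤j eq = trans (csp-above k≤j) (m≡n⇒+m-+n≡0 eq)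

  csp-below-hook : ∀ {i j} → j < i → c j ≡ suc (r j) → csp λp i j ≡ hook λp i j
  csp-below-hook {i} {j} j<i cj≡1+rj = trans (csp-below j<i) (cong (λ x → + x ℤ.- + (i + j)) (begin
    r i + r j + 2         ≡⟨ +-assoc (r i) (r j) 2 ⟩
    r i + (r j + 2)       ≡⟨ cong (λ x → r i + x) (+-suc (r j) 1) ⟩
    r i + (suc (r j) + 1) ≡⟨ +-assoc (r i) (suc (r j)) 1 ⟨
    r i + suc (r j) + 1   ≡⟨ cong (λ x → r i + x + 1) cj≡1+rj ⟨
    r i + c j + 1         ∎))
    where open ≡-Reasoning

  csp-above-hook : ∀ {i j} → i ≤ j → c i ≡ suc (r i) → csp λp i j ≡ - hook λp i j
  csp-above-hook {i} {j} i≤j ci≡1+ri = begin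
    csp λp i j                      ≡⟨ csp-above i≤j ⟩
    + (i + j) ℤ.- + (c i + c j)     ≡⟨ cong (λ x → + (i + j) ℤ.- + (x + c j)) ci≡1+ri ⟩
    + (i + j) ℤ.- + suc (r i + c j) ≡⟨ cong (λ x → + (i + j) ℤ.- + x) (+-comm 1 (r i + c j)) ⟩
    + (i + j) ℤ.- + (r i + c j + 1) ≡⟨ -[+m-+n]≡+n-+m (r i + c j + 1) (i + j) ⟨
    - hook λp i j                   ∎
    where open ≡-Reasoning

  hook-nonzero : ∀ {i j} → Cell λp i j → hook λp i j ≢ + 0
  hook-nonzero {i} {j} (1≤i , 1≤j , j≤ri) hook≡0 = <-irrefl (sym (+m-+n≡0⇒m≡n hook≡0)) (begin-strict
    i + j         ≤⟨ +-mono-≤ (row⇒col (partition-conjugate λp) 1≤i 1≤j j≤ri) j≤ri ⟩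
    c j + r i     ≡⟨ +-comm (c j) (r i) ⟩
    r i + c j     <⟨ m<m+n (r i + c j) (s≤s z≤n) ⟩
    r i + c j + 1 ∎)
    where open ≤-Reasoning

  diagonal-balanced : (∀ i j → Cell λp i j → csp λp i j ≢ + 0) →
                      ∀ {m} → 1 ≤ m → m ≤ r m → c m ≡ suc (r m)
  diagonal-balanced nz = balanced (partition-conjugate λp)
    (λ 1≤k k≤j j≤rk → nz _ _ (1≤k , ≤-trans 1≤k k≤j , j≤rk) ∘ csp-above-zero k≤j)
    (λ 1≤k k<i k≤ri → nz _ _ (≤-trans (s≤s z≤n) k<i , 1≤k , k≤ri) ∘ csp-below-zero k<i)

  csp≡±hook : (∀ {m} → 1 ≤ m → m ≤ r m → c m ≡ suc (r m)) → ∀ {i j} → Cell λp i j →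
              (j < i → csp λp i j ≡ hook λp i j) × (i ≤ j → csp λp i j ≡ - hook λp i j)
  csp≡±hook diagonal {i} {j} (1≤i , 1≤j , j≤ri) =
      (λ j<i → csp-below-hook j<i (diagonal 1≤j (≤-trans j≤ri (r-antitone conj 1≤j (<⇒≤ j<i)))))
    , (λ i≤j → csp-above-hook i≤j (diagonal 1≤i (≤-trans i≤j j≤ri)))
    where conj = partition-conjugate λp

  csp≡±hook⇒csp≢0 : ∀ {i j} → Cell λp i j →
                    (j < i → csp λp i j ≡ hook λp i j) × (i ≤ j → csp λp i j ≡ - hook λp i j) →
                    csp λp i j ≢ + 0
  csp≡±hook⇒csp≢0 {i} {j} cell (below , above) csp≡0 with j <? i
  ... | yes j<i = hook-nonzero cell (trans (sym (below j<i)) csp≡0)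
  ... | no j≮i  = hook-nonzero cell (ℤ.neg-injective (trans (sym (above (≮⇒≥ j≮i))) csp≡0))

corollary2p8 : (λp : Partition) → NonEmpty λp →
    ((∀ i j → Cell λp i j → ¬ (csp λp i j ≡ + 0))
    ⇔ (∀ i j → Cell λp i j →
    (j < i → csp λp i j ≡ hook λp i j)
    × (i ≤ j → csp λp i j ≡ - hook λp i j)))
corollary2p8 λp _ = mk⇔
  (λ nonvanishing i j → csp≡±hook λp (diagonal-balanced λp nonvanishing))
  (λ hook-formula i j cell → csp≡±hook⇒csp≢0 λp cell (hook-formula i j cell))
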